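{- Let $\mathcal{L}=(L,\leq)$ be a finite congruence-uniform lattice. If $\Gamma(x)=\Psi(x)$ for every $x\in L$, then $\mathcal{L}$ is distributive.
   Context: A finite lattice is congruence uniform if it can be obtained from the one-element lattice by a finite sequence of interval doublings, where the doubling of a poset $\mathcal{P}=(P,\leq)$ by $X\subseteq P$ is the subposet of $\mathcal{P}\times\{0<1\}$ on $(P_{\leq X}\times\{0\})\uplus(((P\setminus P_{\leq X})\cup X)\times\{1\})$ with $P_{\leq X}=\{y\mid y\le x\text{ for some }x\in X\}$. Such lattices are semidistributive. An element $j$ is join-irreducible if $j=x\vee y$ implies $j\in\{x,y\}$; it has a unique lower cover $j_*$. Cover relations $x\lessdot y$ and $u\lessdot v$ are perspective if either ($v\vee x=y$ and $v\wedge x=u$) or ($u\vee y=v$ and $u\wedge y=x$). For each cover relation $x\lessdot y$ there is a unique join-irreducible $j$ with $(x,y)$ and $(j_*,j)$ perspective; write $\gamma(x,y)=j$. The nucleus of $x$ is $x_\downarrow=\bigwedge_{y\lessdot x}y$ (with $x_\downarrow=x$ if $x$ has no lower cover), and $\Psi(x)=\{\gamma(u,v)\mid x_\downarrow\le u\lessdot v\le x\}$. $\Gamma(x)$ is the canonical join representation of $x$: the set $X$ with $\bigvee X=x$ such that for every $Y$ with $\bigvee Y=x$, every element of $X$ lies below some element of $Y$ (it exists in finite congruence-uniform lattices and equals $\{\gamma(y,x)\mid y\lessdot x\}$). -}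

module Defs where

open import Data.Nat using (ℕ)
open import Data.Fin using (Fin)
open import Data.Fin.Subset using (Subset; _∈_; _⊂_)
open import Data.Bool using (Bool; true; false)
import Data.Bool as B
open import Data.Unit using (⊤)
open import Data.Product using (Σ; ∃; ∃-syntax; _×_; _,_)
open import Data.Sum using (_⊎_)
open import Relation.Nullary using (¬_)
open import Relation.Binary.PropositionalEquality using (_≡_; _≢_)
open import Relation.Binary.Lattice.Structures using (IsLattice)

record FinLattice : Set₁ where
  field
    n         : ℕ
    _≤_       : Fin n → Fin n → Set
    _∨_       : Fin n → Fin n → Fin n
    _∧_       : Fin n → Fin n → Fin n
    isLattice : IsLattice _≡_ _≤_ _∨_ _∧_

record Ord : Set₁ where
  field
    Carrier : Set
    _≼_     : Carrier → Carrier → Set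

open Ord

one : Ord
one = record { Carrier = ⊤ ; _≼_ = λ _ _ → ⊤ }

DownSet : (P : Ord) → (Carrier P → Set) → Carrier P → Set
DownSet P X y = ∃[ x ] (X x × _≼_ P y x)

-- The doubling of P by X: the subposet of P × {0<1} on
-- (P_{≤X} × {0}) ⊎ (((P ∖ P_{≤X}) ∪ X) × {1}), with the product order.
InDouble : (P : Ord) → (Carrier P → Set) → Carrier P × Bool → Set
InDouble P X (p , false) = DownSet P X p
InDouble P X (p , true)  = ¬ DownSet P X p ⊎ X p

double : (P : Ord) → (Carrier P → Set) → Ord
double P X = record
  { Carrier = Σ (Carrier P × Bool) (InDouble P X)
  ; _≼_ = λ { ((p , b) , _) ((q , c) , _) → _≼_ P p q × (b B.≤ c) }
  }

Interval : (P : Ord) → Carrier P → Carrier P → Carrier P → Set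
Interval P a b y = _≼_ P a y × _≼_ P y b

data Doubling : Ord → Set₁ where
  base : Doubling one
  step : ∀ {P} → Doubling P → (a b : Carrier P) → _≼_ P a b →
         Doubling (double P (Interval P a b))

-- order isomorphism: an order embedding that is surjective up to the
-- equivalence induced by the order of P (the carrier of a doubled poset
-- carries proof components, so equality there is taken as x ≤ y ≤ x).
OrderIso : FinLattice → Ord → Set
OrderIso L P =
  Σ (Fin (FinLattice.n L) → Carrier P) λ f →
    (∀ x y → (FinLattice._≤_ L x y → _≼_ P (f x) (f y))
           × (_≼_ P (f x) (f y) → FinLattice._≤_ L x y))
    × (∀ c → ∃[ x ] (_≼_ P (f x) c × _≼_ P c (f x)))

CongruenceUniform : FinLattice → Set₁
CongruenceUniform L = ∃[ P ] (Doubling P × OrderIso L P)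

module _ (L : FinLattice) where
  open FinLattice L

  _<_ : Fin n → Fin n → Set
  x < y = x ≤ y × x ≢ y

  _⋖_ : Fin n → Fin n → Set
  x ⋖ y = x < y × (∀ z → x ≤ z → z ≤ y → z ≡ x ⊎ z ≡ y)

  JoinIrreducible : Fin n → Set
  JoinIrreducible j = (∃[ y ] (y ⋖ j)) × (∀ x y → j ≡ x ∨ y → j ≡ x ⊎ j ≡ y)

  Perspective : Fin n → Fin n → Fin n → Fin n → Set
  Perspective x y u v = ((v ∨ x ≡ y) × (v ∧ x ≡ u)) ⊎ ((u ∨ y ≡ v) × (u ∧ y ≡ x))

  IsGamma : Fin n → Fin n → Fin n → Set
  IsGamma x y j = JoinIrreducible j × ∃[ j* ] (j* ⋖ j × Perspective x y j* j)

  -- d is the nucleus x↓ = ⋀ {y | y ⋖ x}  (= x if x has no lower cover);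
  -- equivalently d is the meet of {x} ∪ {lower covers of x}.
  IsNucleus : Fin n → Fin n → Set
  IsNucleus x d = d ≤ x × (∀ y → y ⋖ x → d ≤ y)
                × (∀ z → z ≤ x → (∀ y → y ⋖ x → z ≤ y) → z ≤ d)

  InΨ : Fin n → Fin n → Set
  InΨ x j = ∃[ d ] (IsNucleus x d ×
            ∃[ u ] ∃[ v ] (d ≤ u × u ⋖ v × v ≤ x × IsGamma u v j))

  IsJoinOf : Subset n → Fin n → Set
  IsJoinOf X x = (∀ a → a ∈ X → a ≤ x) × (∀ z → (∀ a → a ∈ X → a ≤ z) → x ≤ z)

  IsCanonicalJoinRep : Fin n → Subset n → Set
  IsCanonicalJoinRep x X =
    IsJoinOf X x
    × (∀ Y → Y ⊂ X → ¬ IsJoinOf Y x)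
    × (∀ Y → IsJoinOf Y x → ∀ a → a ∈ X → ∃[ b ] (b ∈ Y × a ≤ b))

  Distributive : Set
  Distributive = ∀ x y z → x ∧ (y ∨ z) ≡ (x ∧ y) ∨ (x ∧ z)

-- A lattice built by interval doublings is semidistributive, by induction on
-- the doublings: bounds in a doubled poset project onto bounds in the original
-- one, so the original laws hold after projection, and the layer coordinate
-- could only break them if a meet of two upper-layer elements of the doubled
-- interval fell into the lower layer (dually for joins), which it cannot.
-- In a finite semidistributive lattice, Γ(x) consists of the least elements
-- below x but not below y, for the lower covers y of x.  Given Ψ(x) ⊆ Γ(x),
-- every join-irreducible j with lower cover j* is join-prime: take x = p ∨ q
-- minimal with j ≤ x, j ≰ p, j ≰ q.  Meet-semidistributivity puts j below
-- p ∨ j* or q ∨ j*, and minimality then yields a lower cover y of x with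
-- j ≰ y, hence j ≰ d for the nucleus d of x.  Either j ≰ d ∨ j*, and then
-- j = γ(w, d ∨ j* ∨ j) lies in Ψ(x) but not in Γ(x), or minimality forces
-- d ∨ j* = x, which puts x below a lower cover of x above j.  Finally, a
-- finite lattice whose join-irreducibles are join-prime is distributive.

module Submission where

open import Defs hiding (_<_; _⋖_)
open import Data.Bool as Bool using (Bool; true; false; b≤b)
import Data.Bool.Properties as Boolₚ
open import Data.Empty using (⊥; ⊥-elim)
open import Data.Fin using (Fin)
open import Data.Fin.Induction using (po-wellFounded; po-noetherian)
open import Data.Fin.Properties using (_≟_; any?; all?)
open import Data.Fin.Subset using (Subset; _∈_; _∉_; _⊂_)
open import Data.Fin.Subset.Properties using (_∈?_)
open import Data.List using (List; []; _∷_; allFin)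
import Data.List.Membership.Propositional as List
open import Data.List.Membership.Propositional.Properties using (∈-allFin)
open import Data.List.Relation.Unary.Any using (here; there)
open import Data.Product using (Σ; ∃; ∃-syntax; ∃₂; _×_; _,_; proj₁; proj₂)
open import Data.Sum using (_⊎_; inj₁; inj₂; [_,_]′)
open import Data.Unit using (tt)
open import Data.Vec using (tabulate)
open import Data.Vec.Properties using (lookup∘tabulate; []=⇒lookup; lookup⇒[]=)
open import Function using (flip; Equivalence)
open import Induction.WellFounded using (WellFounded; Acc; acc)
open import Level using (0ℓ)
open import Relation.Binary.Definitions using (Reflexive; Transitive; Decidable)
open import Relation.Binary.Lattice.Bundles using (JoinSemilattice)
open import Relation.Binary.Lattice.Structures using (IsLattice)
open import Relation.Binary.PropositionalEquality using (_≡_; _≢_; refl; sym; trans; subst; subst₂)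
open import Relation.Nullary using (¬_; yes; no)
open import Relation.Nullary.Decidable using (_×-dec_; _⊎-dec_; _→-dec_; ¬?; map′; ⌊_⌋; toWitness; fromWitness; decidable-stable)
import Relation.Binary.Construct.NonStrictToStrict as NonStrictToStrict
import Relation.Binary.Lattice.Properties.JoinSemilattice as JoinSemilatticeProperties
import Relation.Unary as U

module _ (P : Ord) where
  open Ord P renaming (_≼_ to _⊑_)

  record IsLub (x y s : Carrier) : Set where
    constructor isLub
    field
      upperˡ : x ⊑ s
      upperʳ : y ⊑ s
      least  : ∀ w → x ⊑ w → y ⊑ w → s ⊑ w

  record IsGlb (x y m : Carrier) : Set where
    constructor isGlb
    field
      lowerˡ   : m ⊑ x
      lowerʳ   : m ⊑ y
      greatest : ∀ w → w ⊑ x → w ⊑ y → w ⊑ m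

  HasLubs : Set
  HasLubs = ∀ x y → ∃ (IsLub x y)

  HasGlbs : Set
  HasGlbs = ∀ x y → ∃ (IsGlb x y)

  LubSemidistributive : Set
  LubSemidistributive = ∀ {x y z s m} → IsLub x y s → IsLub x z s → IsGlb y z m → IsLub x m s

  GlbSemidistributive : Set
  GlbSemidistributive = ∀ {x y z s m} → IsGlb x y s → IsGlb x z s → IsLub y z m → IsGlb x m s

true≰false : ¬ true Bool.≤ false
true≰false ()

bool-≰ : ∀ {e f} → ¬ e Bool.≤ f → e ≡ true × f ≡ false
bool-≰ {false} {f}     e≰f = ⊥-elim (e≰f (Boolₚ.≤-minimum f))
bool-≰ {true}  {true}  e≰f = ⊥-elim (e≰f b≤b)
bool-≰ {true}  {false} _   = refl , refl

doubling-refl : ∀ {P} → Doubling P → Reflexive (Ord._≼_ P)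
doubling-refl base           = tt
doubling-refl (step d _ _ _) = doubling-refl d , Boolₚ.≤-refl

doubling-trans : ∀ {P} → Doubling P → Transitive (Ord._≼_ P)
doubling-trans base           _       _       = tt
doubling-trans (step d _ _ _) (p , e) (q , f) = doubling-trans d p q , Boolₚ.≤-trans e f

doubling-dec : ∀ {P} → Doubling P → Decidable (Ord._≼_ P)
doubling-dec base           _               _               = yes tt
doubling-dec (step d _ _ _) ((p , e) , _) ((q , f) , _) = doubling-dec d p q ×-dec (e Boolₚ.≤? f)

module Doubled (P : Ord) (a b : Ord.Carrier P) (a⊑b : Ord._≼_ P a b)
  (⊑-refl : Reflexive (Ord._≼_ P)) (⊑-trans : Transitive (Ord._≼_ P)) (_⊑?_ : Decidable (Ord._≼_ P))
  where
  open Ord P renaming (_≼_ to _⊑_)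

  D : Ord
  D = double P (Interval P a b)

  open Ord D using () renaming (Carrier to C; _≼_ to _≤D_)

  π : C → Carrier
  π u = proj₁ (proj₁ u)

  layer : C → Bool
  layer u = proj₂ (proj₁ u)

  ≤D-trans : Transitive _≤D_
  ≤D-trans (p , e) (q , f) = ⊑-trans p q , Boolₚ.≤-trans e f

  downSet⇒⊑b : ∀ {p} → DownSet P (Interval P a b) p → p ⊑ b
  downSet⇒⊑b (_ , (_ , x⊑b) , p⊑x) = ⊑-trans p⊑x x⊑b

  ⊑b⇒downSet : ∀ {p} → p ⊑ b → DownSet P (Interval P a b) p
  ⊑b⇒downSet p⊑b = b , (a⊑b , ⊑-refl) , p⊑b

  lower⇒⊑b : ∀ u → layer u ≡ false → π u ⊑ b
  lower⇒⊑b ((_ , false) , down) refl = downSet⇒⊑b down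

  upper⇒a⊑ : ∀ u → layer u ≡ true → π u ⊑ b → a ⊑ π u
  upper⇒a⊑ ((_ , true) , inj₁ ¬down)     refl p⊑b = ⊥-elim (¬down (⊑b⇒downSet p⊑b))
  upper⇒a⊑ ((_ , true) , inj₂ (a⊑p , _)) refl _   = a⊑p

  upperLift : ∀ r → Σ C λ u → π u ≡ r × (∀ v → π v ⊑ r → v ≤D u)
  upperLift r with r ⊑? b
  ... | no r⋢b = ((r , true) , inj₁ (λ down → r⋢b (downSet⇒⊑b down))) , refl ,
                 λ v v⊑r → v⊑r , Boolₚ.≤-maximum _
  ... | yes r⊑b with a ⊑? r
  ...   | yes a⊑r = ((r , true) , inj₂ (a⊑r , r⊑b)) , refl , λ v v⊑r → v⊑r , Boolₚ.≤-maximum _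
  ...   | no a⋢r  = ((r , false) , ⊑b⇒downSet r⊑b) , refl , λ v v⊑r → v⊑r , lower v v⊑r
    where
    lower : ∀ v → π v ⊑ r → layer v Bool.≤ false
    lower ((_ , false) , _)                _   = b≤b
    lower ((_ , true)  , inj₁ ¬down)       v⊑r = ⊥-elim (¬down (⊑b⇒downSet (⊑-trans v⊑r r⊑b)))
    lower ((_ , true)  , inj₂ (a⊑v , _)) v⊑r = ⊥-elim (a⋢r (⊑-trans a⊑v v⊑r))

  lowerLift : ∀ r → Σ C λ u → π u ≡ r × (∀ v → r ⊑ π v → u ≤D v)
  lowerLift r with r ⊑? b
  ... | yes r⊑b = ((r , false) , ⊑b⇒downSet r⊑b) , refl , λ v r⊑v → r⊑v , Boolₚ.≤-minimum _
  ... | no r⋢b  = ((r , true) , inj₁ (λ down → r⋢b (downSet⇒⊑b down))) , refl , λ v r⊑v → r⊑v , upper v r⊑v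
    where
    upper : ∀ v → r ⊑ π v → true Bool.≤ layer v
    upper ((_ , true)  , _)    _   = b≤b
    upper ((_ , false) , down) r⊑v = ⊥-elim (r⋢b (⊑-trans r⊑v (downSet⇒⊑b down)))

  isLub-π : ∀ {u v s} → IsLub D u v s → IsLub P (π u) (π v) (π s)
  isLub-π {u} {v} {s} (isLub u≤s v≤s s-least) = isLub (proj₁ u≤s) (proj₁ v≤s) λ r u⊑r v⊑r →
    let (r̂ , πr̂≡r , below-r̂) = upperLift r in
    subst (π s ⊑_) πr̂≡r (proj₁ (s-least r̂ (below-r̂ u u⊑r) (below-r̂ v v⊑r)))

  isGlb-π : ∀ {u v m} → IsGlb D u v m → IsGlb P (π u) (π v) (π m)
  isGlb-π {u} {v} {m} (isGlb m≤u m≤v m-greatest) = isGlb (proj₁ m≤u) (proj₁ m≤v) λ r r⊑u r⊑v →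
    let (r̂ , πr̂≡r , above-r̂) = lowerLift r in
    subst (_⊑ π m) πr̂≡r (proj₁ (m-greatest r̂ (above-r̂ u r⊑u) (above-r̂ v r⊑v)))

  hasLubs-π : HasLubs D → HasLubs P
  hasLubs-π lubs p q =
    let (p̂ , πp̂≡p , _) = upperLift p
        (q̂ , πq̂≡q , _) = upperLift q
        (ŝ , ŝ-lub)     = lubs p̂ q̂
    in π ŝ , subst₂ (λ p q → IsLub P p q (π ŝ)) πp̂≡p πq̂≡q (isLub-π ŝ-lub)

  hasGlbs-π : HasGlbs D → HasGlbs P
  hasGlbs-π glbs p q =
    let (p̂ , πp̂≡p , _) = lowerLift p
        (q̂ , πq̂≡q , _) = lowerLift q
        (m̂ , m̂-glb)     = glbs p̂ q̂
    in π m̂ , subst₂ (λ p q → IsGlb P p q (π m̂)) πp̂≡p πq̂≡q (isGlb-π m̂-glb)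

  lub-of-lowers : ∀ {y z m} → IsLub D y z m → layer y ≡ false → layer z ≡ false → layer m ≡ false
  lub-of-lowers {y} {z} {m} m-lub@(isLub y≤m z≤m m-least) y₀ z₀ =
    Boolₚ.≤-antisym (proj₂ (m-least m̌ (proj₁ y≤m , Boolₚ.≤-reflexive y₀) (proj₁ z≤m , Boolₚ.≤-reflexive z₀)))
                    (Boolₚ.≤-minimum _)
    where
    m̌ : C
    m̌ = (π m , false) , ⊑b⇒downSet (IsLub.least (isLub-π m-lub) b (lower⇒⊑b y y₀) (lower⇒⊑b z z₀))

  glb-of-uppers : ∀ {y z m} → IsGlb D y z m → layer y ≡ true → layer z ≡ true →
                  π y ⊑ b → π z ⊑ b → layer m ≡ true
  glb-of-uppers {y} {z} {m} m-glb@(isGlb m≤y m≤z m-greatest) y₁ z₁ πy⊑b πz⊑b =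
    Boolₚ.≤-antisym (Boolₚ.≤-maximum _)
      (proj₂ (m-greatest m̂ (proj₁ m≤y , Boolₚ.≤-reflexive (sym y₁)) (proj₁ m≤z , Boolₚ.≤-reflexive (sym z₁))))
    where
    a⊑πm : a ⊑ π m
    a⊑πm = IsGlb.greatest (isGlb-π m-glb) a (upper⇒a⊑ y y₁ πy⊑b) (upper⇒a⊑ z z₁ πz⊑b)
    m̂ : C
    m̂ = (π m , true) , inj₂ (a⊑πm , ⊑-trans (proj₁ m≤y) πy⊑b)

  lubSD-lifts : HasLubs D → LubSemidistributive P → LubSemidistributive D
  lubSD-lifts lubs sdP {x} {y} {z} {s} {m} s=x∨y s=x∨z m=y∧z =
    isLub (IsLub.upperˡ s=x∨y) (≤D-trans {m} {y} {s} (IsGlb.lowerˡ m=y∧z) (IsLub.upperʳ s=x∨y))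
          (λ t x≤t m≤t → ≤D-trans {s} {w} {t} s≤w (IsLub.least w-lub t x≤t m≤t))
    where
    w = proj₁ (lubs x m)
    w-lub = proj₂ (lubs x m)
    open IsLub w-lub using () renaming (upperˡ to x≤w; upperʳ to m≤w)
    πs⊑πw : π s ⊑ π w
    πs⊑πw = IsLub.least (sdP (isLub-π s=x∨y) (isLub-π s=x∨z) (isGlb-π m=y∧z)) (π w) (proj₁ x≤w) (proj₁ m≤w)
    πy⊑πw : π y ⊑ π w
    πy⊑πw = ⊑-trans (proj₁ (IsLub.upperʳ s=x∨y)) πs⊑πw
    πz⊑πw : π z ⊑ π w
    πz⊑πw = ⊑-trans (proj₁ (IsLub.upperʳ s=x∨z)) πs⊑πw
    s≤w : s ≤D w
    s≤w with layer y Boolₚ.≤? layer w | layer z Boolₚ.≤? layer w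
    ... | yes y≤w | _       = IsLub.least s=x∨y w x≤w (πy⊑πw , y≤w)
    ... | no _    | yes z≤w = IsLub.least s=x∨z w x≤w (πz⊑πw , z≤w)
    -- Otherwise y and z lie in the upper copy of the interval below π w ⊑ b,
    -- so their meet m does too, contradicting m ≤ w in the lower layer.
    ... | no y≰w  | no z≰w  =
      let (y₁ , w₀) = bool-≰ y≰w
          (z₁ , _)  = bool-≰ z≰w
          πw⊑b      = lower⇒⊑b w w₀
          m₁        = glb-of-uppers m=y∧z y₁ z₁ (⊑-trans πy⊑πw πw⊑b) (⊑-trans πz⊑πw πw⊑b)
      in ⊥-elim (true≰false (subst₂ Bool._≤_ m₁ w₀ (proj₂ m≤w)))

  glbSD-lifts : HasGlbs D → GlbSemidistributive P → GlbSemidistributive D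
  glbSD-lifts glbs sdP {x} {y} {z} {s} {m} s=x∧y s=x∧z m=y∨z =
    isGlb (IsGlb.lowerˡ s=x∧y) (≤D-trans {s} {y} {m} (IsGlb.lowerʳ s=x∧y) (IsLub.upperˡ m=y∨z))
          (λ t t≤x t≤m → ≤D-trans {t} {w} {s} (IsGlb.greatest w-glb t t≤x t≤m) w≤s)
    where
    w = proj₁ (glbs x m)
    w-glb = proj₂ (glbs x m)
    open IsGlb w-glb using () renaming (lowerˡ to w≤x; lowerʳ to w≤m)
    πw⊑πs : π w ⊑ π s
    πw⊑πs = IsGlb.greatest (sdP (isGlb-π s=x∧y) (isGlb-π s=x∧z) (isLub-π m=y∨z)) (π w) (proj₁ w≤x) (proj₁ w≤m)
    w≤s : w ≤D s
    w≤s with layer w Boolₚ.≤? layer y | layer w Boolₚ.≤? layer z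
    ... | yes w≤y | _       = IsGlb.greatest s=x∧y w w≤x (⊑-trans πw⊑πs (proj₁ (IsGlb.lowerʳ s=x∧y)) , w≤y)
    ... | no _    | yes w≤z = IsGlb.greatest s=x∧z w w≤x (⊑-trans πw⊑πs (proj₁ (IsGlb.lowerʳ s=x∧z)) , w≤z)
    ... | no w≰y  | no w≰z  =
      let (w₁ , y₀) = bool-≰ w≰y
          (_ , z₀)  = bool-≰ w≰z
      in ⊥-elim (true≰false (subst₂ Bool._≤_ w₁ (lub-of-lowers m=y∨z y₀ z₀) (proj₂ w≤m)))

doubling-semidistributive : ∀ {P} → Doubling P → HasLubs P → HasGlbs P →
                            LubSemidistributive P × GlbSemidistributive P
doubling-semidistributive base _ _ =
  (λ _ _ _ → isLub tt tt λ _ _ _ → tt) , (λ _ _ _ → isGlb tt tt λ _ _ _ → tt)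
doubling-semidistributive (step {P} d a b a⊑b) lubs glbs =
  lubSD-lifts lubs (proj₁ ih) , glbSD-lifts glbs (proj₂ ih)
  where
  open Doubled P a b a⊑b (doubling-refl d) (doubling-trans d) (doubling-dec d)
  ih = doubling-semidistributive d (hasLubs-π lubs) (hasGlbs-π glbs)

module _ (L : FinLattice) where
  open FinLattice L

  JoinSemidistributive : Set
  JoinSemidistributive = ∀ x y z → x ∨ y ≡ x ∨ z → x ∨ (y ∧ z) ≡ x ∨ y

  MeetSemidistributive : Set
  MeetSemidistributive = ∀ x y z → x ∧ y ≡ x ∧ z → x ∧ (y ∨ z) ≡ x ∧ y

module OrderIsomorphic (L : FinLattice) {P : Ord} (⊑-trans : Transitive (Ord._≼_ P)) (iso : OrderIso L P) where
  open FinLattice L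
  open IsLattice isLattice using (x≤x∨y; y≤x∨y; ∨-least; x∧y≤x; x∧y≤y; ∧-greatest; antisym)
  open Ord P renaming (_≼_ to _⊑_)

  f : Fin n → Carrier
  f = proj₁ iso

  f-mono : ∀ {x y} → x ≤ y → f x ⊑ f y
  f-mono = proj₁ (proj₁ (proj₂ iso) _ _)

  f-reflect : ∀ {x y} → f x ⊑ f y → x ≤ y
  f-reflect = proj₂ (proj₁ (proj₂ iso) _ _)

  f-surjective : ∀ c → ∃[ x ] (f x ⊑ c × c ⊑ f x)
  f-surjective = proj₂ (proj₂ iso)

  f-∨ : ∀ x y → IsLub P (f x) (f y) (f (x ∨ y))
  f-∨ x y = isLub (f-mono (x≤x∨y x y)) (f-mono (y≤x∨y x y)) λ c x⊑c y⊑c →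
    let (z , fz⊑c , c⊑fz) = f-surjective c in
    ⊑-trans (f-mono (∨-least (f-reflect (⊑-trans x⊑c c⊑fz)) (f-reflect (⊑-trans y⊑c c⊑fz)))) fz⊑c

  f-∧ : ∀ x y → IsGlb P (f x) (f y) (f (x ∧ y))
  f-∧ x y = isGlb (f-mono (x∧y≤x x y)) (f-mono (x∧y≤y x y)) λ c c⊑x c⊑y →
    let (z , fz⊑c , c⊑fz) = f-surjective c in
    ⊑-trans c⊑fz (f-mono (∧-greatest (f-reflect (⊑-trans fz⊑c c⊑x)) (f-reflect (⊑-trans fz⊑c c⊑y))))

  hasLubs : HasLubs P
  hasLubs c d =
    let (x , fx⊑c , c⊑fx) = f-surjective c
        (y , fy⊑d , d⊑fy) = f-surjective d
        isLub fx⊑s fy⊑s s-least = f-∨ x y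
    in f (x ∨ y) , isLub (⊑-trans c⊑fx fx⊑s) (⊑-trans d⊑fy fy⊑s)
                         λ w c⊑w d⊑w → s-least w (⊑-trans fx⊑c c⊑w) (⊑-trans fy⊑d d⊑w)

  hasGlbs : HasGlbs P
  hasGlbs c d =
    let (x , fx⊑c , c⊑fx) = f-surjective c
        (y , fy⊑d , d⊑fy) = f-surjective d
        isGlb m⊑fx m⊑fy m-greatest = f-∧ x y
    in f (x ∧ y) , isGlb (⊑-trans m⊑fx fx⊑c) (⊑-trans m⊑fy fy⊑d)
                         λ w w⊑c w⊑d → m-greatest w (⊑-trans w⊑c c⊑fx) (⊑-trans w⊑d d⊑fy)

  lub-unique : ∀ {x y s} → IsLub P (f x) (f y) (f s) → s ≡ x ∨ y
  lub-unique {x} {y} s-lub = antisym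
    (f-reflect (IsLub.least s-lub _ (IsLub.upperˡ (f-∨ x y)) (IsLub.upperʳ (f-∨ x y))))
    (f-reflect (IsLub.least (f-∨ x y) _ (IsLub.upperˡ s-lub) (IsLub.upperʳ s-lub)))

  glb-unique : ∀ {x y m} → IsGlb P (f x) (f y) (f m) → m ≡ x ∧ y
  glb-unique {x} {y} m-glb = antisym
    (f-reflect (IsGlb.greatest (f-∧ x y) _ (IsGlb.lowerˡ m-glb) (IsGlb.lowerʳ m-glb)))
    (f-reflect (IsGlb.greatest m-glb _ (IsGlb.lowerˡ (f-∧ x y)) (IsGlb.lowerʳ (f-∧ x y))))

  joinSemidistributive : LubSemidistributive P → JoinSemidistributive L
  joinSemidistributive sdP x y z x∨y≡x∨z =
    sym (lub-unique (sdP (f-∨ x y) (subst (λ s → IsLub P (f x) (f z) (f s)) (sym x∨y≡x∨z) (f-∨ x z)) (f-∧ y z)))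

  meetSemidistributive : GlbSemidistributive P → MeetSemidistributive L
  meetSemidistributive sdP x y z x∧y≡x∧z =
    sym (glb-unique (sdP (f-∧ x y) (subst (λ m → IsGlb P (f x) (f z) (f m)) (sym x∧y≡x∧z) (f-∧ x z)) (f-∨ y z)))

congruenceUniform⇒semidistributive : ∀ L → CongruenceUniform L → JoinSemidistributive L × MeetSemidistributive L
congruenceUniform⇒semidistributive L (P , d , iso) =
  joinSemidistributive (proj₁ sd) , meetSemidistributive (proj₂ sd)
  where
  open OrderIsomorphic L (doubling-trans d) iso
  sd = doubling-semidistributive d hasLubs hasGlbs

module FiniteLattice (L : FinLattice) where
  open FinLattice L
  open IsLattice isLattice
    using (x≤x∨y; y≤x∨y; ∨-least; x∧y≤x; x∧y≤y; ∧-greatest; antisym; isPartialOrder; isJoinSemilattice)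
    renaming (refl to ≤-refl; trans to ≤-trans)

  infix 4 _<_ _⋖_

  _<_ : Fin n → Fin n → Set
  _<_ = Defs._<_ L

  _⋖_ : Fin n → Fin n → Set
  _⋖_ = Defs._⋖_ L

  joinSemilattice : JoinSemilattice 0ℓ 0ℓ 0ℓ
  joinSemilattice = record { isJoinSemilattice = isJoinSemilattice }

  open JoinSemilatticeProperties joinSemilattice using (∨-comm; ∨-monotonic)

  _≤?_ : Decidable _≤_
  x ≤? y = map′ (λ x∨y≡y → subst (x ≤_) x∨y≡y (x≤x∨y x y))
                (λ x≤y → antisym (∨-least x≤y ≤-refl) (y≤x∨y x y))
                (x ∨ y ≟ y)

  _<?_ : Decidable _<_
  _<?_ = NonStrictToStrict.<-decidable _≡_ _≤_ _≟_ _≤?_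

  <-wellFounded : WellFounded _<_
  <-wellFounded = po-wellFounded isPartialOrder

  >-wellFounded : WellFounded (flip _<_)
  >-wellFounded = po-noetherian isPartialOrder

  _⋖?_ : Decidable _⋖_
  x ⋖? y = x <? y ×-dec all? (λ z → x ≤? z →-dec (z ≤? y →-dec (z ≟ x ⊎-dec z ≟ y)))

  ∧-< : ∀ {x z} → ¬ x ≤ z → x ∧ z < x
  ∧-< {x} {z} x≰z = x∧y≤x x z , λ x∧z≡x → x≰z (subst (_≤ z) x∧z≡x (x∧y≤y x z))

  ≤⇒∧≡ : ∀ {x y} → x ≤ y → x ∧ y ≡ x
  ≤⇒∧≡ x≤y = antisym (x∧y≤x _ _) (∧-greatest ≤-refl x≤y)

  module _ {Q : Fin n → Set} (Q? : U.Decidable Q) where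

    minimal-below : ∀ {x} → Q x → ∃[ m ] (m ≤ x × Q m × (∀ {t} → t < m → ¬ Q t))
    minimal-below {x} Qx = go x (<-wellFounded x) ≤-refl Qx
      where
      go : ∀ a → Acc _<_ a → a ≤ x → Q a → ∃[ m ] (m ≤ x × Q m × (∀ {t} → t < m → ¬ Q t))
      go a (acc rs) a≤x Qa with any? (λ t → t <? a ×-dec Q? t)
      ... | yes (t , t<a , Qt) = go t (rs t<a) (≤-trans (proj₁ t<a) a≤x) Qt
      ... | no ∄t              = a , a≤x , Qa , λ t<a Qt → ∄t (_ , t<a , Qt)

    maximal-above : ∀ {x} → Q x → ∃[ m ] (x ≤ m × Q m × (∀ {t} → m < t → ¬ Q t))
    maximal-above {x} Qx = go x (>-wellFounded x) ≤-refl Qx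
      where
      go : ∀ a → Acc (flip _<_) a → x ≤ a → Q a → ∃[ m ] (x ≤ m × Q m × (∀ {t} → m < t → ¬ Q t))
      go a (acc rs) x≤a Qa with any? (λ t → a <? t ×-dec Q? t)
      ... | yes (t , a<t , Qt) = go t (rs a<t) (≤-trans x≤a (proj₁ a<t)) Qt
      ... | no ∄t              = a , x≤a , Qa , λ a<t Qt → ∄t (_ , a<t , Qt)

  lowerCover-above : ∀ {u v} → u < v → ∃[ w ] (u ≤ w × w ⋖ v)
  lowerCover-above {u} {v} u<v with maximal-above (λ z → u ≤? z ×-dec z <? v) (≤-refl , u<v)
  ... | w , u≤w , (_ , w<v) , maximal = w , u≤w , w<v , covers
    where
    covers : ∀ z → w ≤ z → z ≤ v → z ≡ w ⊎ z ≡ v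
    covers z w≤z z≤v with z ≟ w | z ≟ v
    ... | yes z≡w | _       = inj₁ z≡w
    ... | no _    | yes z≡v = inj₂ z≡v
    ... | no z≢w  | no z≢v  = ⊥-elim (maximal (w≤z , λ w≡z → z≢w (sym w≡z)) (≤-trans u≤w w≤z , z≤v , z≢v))

  ¬≤lowerCover : ∀ {y x} → y ⋖ x → ¬ x ≤ y
  ¬≤lowerCover ((y≤x , y≢x) , _) x≤y = y≢x (antisym y≤x x≤y)

  lowerCover-join : ∀ {y x t} → y ⋖ x → t ≤ x → ¬ t ≤ y → y ∨ t ≡ x
  lowerCover-join ((y≤x , _) , covers) t≤x t≰y with covers _ (x≤x∨y _ _) (∨-least y≤x t≤x)
  ... | inj₁ y∨t≡y = ⊥-elim (t≰y (subst (_ ≤_) y∨t≡y (y≤x∨y _ _)))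
  ... | inj₂ y∨t≡x = y∨t≡x

  <∨ : ∀ {t u} → ¬ t ≤ u → u < u ∨ t
  <∨ {t} {u} t≰u = x≤x∨y u t , λ u≡u∨t → t≰u (subst (t ≤_) (sym u≡u∨t) (y≤x∨y u t))

  lowerCovers-≤⇒≡ : ∀ {y y′ x} → y ⋖ x → y′ ⋖ x → y ≤ y′ → y ≡ y′
  lowerCovers-≤⇒≡ (_ , covers) y′⋖x y≤y′ with covers _ y≤y′ (proj₁ (proj₁ y′⋖x))
  ... | inj₁ y′≡y = sym y′≡y
  ... | inj₂ y′≡x = ⊥-elim (proj₂ (proj₁ y′⋖x) y′≡x)

  meetOfLowerCoversIn : List (Fin n) → Fin n → Fin n
  meetOfLowerCoversIn []       x = x
  meetOfLowerCoversIn (t ∷ ts) x with t ⋖? x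
  ... | yes _ = t ∧ meetOfLowerCoversIn ts x
  ... | no  _ = meetOfLowerCoversIn ts x

  meetOfLowerCoversIn-≤ : ∀ ts x → meetOfLowerCoversIn ts x ≤ x
  meetOfLowerCoversIn-≤ []       x = ≤-refl
  meetOfLowerCoversIn-≤ (t ∷ ts) x with t ⋖? x
  ... | yes _ = ≤-trans (x∧y≤y _ _) (meetOfLowerCoversIn-≤ ts x)
  ... | no  _ = meetOfLowerCoversIn-≤ ts x

  meetOfLowerCoversIn-lowerBound : ∀ {ts x y} → y List.∈ ts → y ⋖ x → meetOfLowerCoversIn ts x ≤ y
  meetOfLowerCoversIn-lowerBound {t ∷ ts} {x} y∈ y⋖x with t ⋖? x | y∈
  ... | yes _   | here refl = x∧y≤x _ _
  ... | no t⋪x | here refl = ⊥-elim (t⋪x y⋖x)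
  ... | yes _   | there y∈ts = ≤-trans (x∧y≤y _ _) (meetOfLowerCoversIn-lowerBound y∈ts y⋖x)
  ... | no _    | there y∈ts = meetOfLowerCoversIn-lowerBound y∈ts y⋖x

  meetOfLowerCoversIn-greatest : ∀ ts {x z} → z ≤ x → (∀ y → y ⋖ x → z ≤ y) → z ≤ meetOfLowerCoversIn ts x
  meetOfLowerCoversIn-greatest []       z≤x _         = z≤x
  meetOfLowerCoversIn-greatest (t ∷ ts) {x} z≤x z≤covers with t ⋖? x
  ... | yes t⋖x = ∧-greatest (z≤covers t t⋖x) (meetOfLowerCoversIn-greatest ts z≤x z≤covers)
  ... | no  _   = meetOfLowerCoversIn-greatest ts z≤x z≤covers

  nucleus : ∀ x → ∃ (IsNucleus L x)
  nucleus x = meetOfLowerCoversIn (allFin n) x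
            , meetOfLowerCoversIn-≤ (allFin n) x
            , (λ y → meetOfLowerCoversIn-lowerBound (∈-allFin y))
            , λ z → meetOfLowerCoversIn-greatest (allFin n)

  IsLeastOutside : Fin n → Fin n → Fin n → Set
  IsLeastOutside y x a = a ≤ x × ¬ a ≤ y × (∀ t → t ≤ x → ¬ t ≤ y → a ≤ t)

  isLeastOutside? : ∀ y x → U.Decidable (IsLeastOutside y x)
  isLeastOutside? y x a = a ≤? x ×-dec ¬? (a ≤? y) ×-dec all? (λ t → t ≤? x →-dec (¬? (t ≤? y) →-dec a ≤? t))

  leastOutside-unique : ∀ {y x a b} → IsLeastOutside y x a → IsLeastOutside y x b → a ≡ b
  leastOutside-unique (a≤x , a≰y , a-least) (b≤x , b≰y , b-least) = antisym (a-least _ b≤x b≰y) (b-least _ a≤x a≰y)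

  IsCanonicalJoinand : Fin n → Fin n → Set
  IsCanonicalJoinand x a = ∃[ y ] (y ⋖ x × IsLeastOutside y x a)

  isCanonicalJoinand? : ∀ x → U.Decidable (IsCanonicalJoinand x)
  isCanonicalJoinand? x a = any? λ y → y ⋖? x ×-dec isLeastOutside? y x a

  -- Γ x is the paper's Γ(x) = {γ(y, x) | y ⋖ x}: under join-semidistributivity
  -- γ(y, x) is the least element below x but not below y.
  Γ : Fin n → Subset n
  Γ x = tabulate λ a → ⌊ isCanonicalJoinand? x a ⌋

  ∈Γ⁻ : ∀ {x a} → a ∈ Γ x → IsCanonicalJoinand x a
  ∈Γ⁻ {x} {a} a∈Γx = toWitness {a? = isCanonicalJoinand? x a} (Equivalence.from Boolₚ.T-≡ (trans (sym (lookup∘tabulate _ a)) ([]=⇒lookup a∈Γx)))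

  ∈Γ⁺ : ∀ {x a} → IsCanonicalJoinand x a → a ∈ Γ x
  ∈Γ⁺ {x} {a} a-joinand = lookup⇒[]= a (Γ x) (trans (lookup∘tabulate _ a) (Equivalence.to Boolₚ.T-≡ (fromWitness a-joinand)))

  Γ-joinPrime : ∀ {p q j} → j ∈ Γ (p ∨ q) → j ≤ p ⊎ j ≤ q
  Γ-joinPrime {p} {q} j∈Γ with ∈Γ⁻ j∈Γ
  ... | y , y⋖p∨q , _ , _ , j-least with p ≤? y | q ≤? y
  ...   | yes p≤y | yes q≤y = ⊥-elim (¬≤lowerCover y⋖p∨q (∨-least p≤y q≤y))
  ...   | no p≰y  | _       = inj₁ (j-least p (x≤x∨y p q) p≰y)
  ...   | yes _   | no q≰y  = inj₂ (j-least q (y≤x∨y p q) q≰y)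

  join-outside-lowerCover : ∀ {Y x y} → IsJoinOf L Y x → y ⋖ x → ∃[ b ] (b ∈ Y × ¬ b ≤ y)
  join-outside-lowerCover {Y} {x} {y} (_ , least) y⋖x with any? (λ b → b ∈? Y ×-dec ¬? (b ≤? y))
  ... | yes b-outside = b-outside
  ... | no ∄b = ⊥-elim (¬≤lowerCover y⋖x (least y λ b b∈Y → decidable-stable (b ≤? y) λ b≰y → ∄b (b , b∈Y , b≰y)))

  Γ-irredundant : ∀ x Y → Y ⊂ Γ x → ¬ IsJoinOf L Y x
  Γ-irredundant x Y (Y⊆Γx , a , a∈Γx , a∉Y) Y-join with ∈Γ⁻ a∈Γx
  ... | y , y⋖x , a-least with join-outside-lowerCover Y-join y⋖x
  ...   | b , b∈Y , b≰y with ∈Γ⁻ (Y⊆Γx b∈Y)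
  ...     | y′ , y′⋖x , b-least with y ≤? y′
  ...       | yes y≤y′ = a∉Y (subst (_∈ Y) (leastOutside-unique b-least a-least′) b∈Y)
    where
    a-least′ : IsLeastOutside y′ x a
    a-least′ = subst (λ y → IsLeastOutside y x a) (lowerCovers-≤⇒≡ y⋖x y′⋖x y≤y′) a-least
  ...       | no y≰y′ = b≰y (proj₂ (proj₂ b-least) y (proj₁ (proj₁ y⋖x)) y≰y′)

  Γ-refines : ∀ x Y → IsJoinOf L Y x → ∀ a → a ∈ Γ x → ∃[ b ] (b ∈ Y × a ≤ b)
  Γ-refines x Y Y-join a a∈Γx with ∈Γ⁻ a∈Γx
  ... | y , y⋖x , _ , _ , a-least with join-outside-lowerCover Y-join y⋖x
  ...   | b , b∈Y , b≰y = b , b∈Y , a-least b (proj₁ Y-join b b∈Y) b≰y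

  module _ (jsd : JoinSemidistributive L) where

    meet-outside-lowerCover : ∀ {y x t₁ t₂} → y ⋖ x → t₁ ≤ x → t₂ ≤ x → ¬ t₁ ≤ y → ¬ t₂ ≤ y → ¬ (t₁ ∧ t₂) ≤ y
    meet-outside-lowerCover {y} {x} {t₁} {t₂} y⋖x t₁≤x t₂≤x t₁≰y t₂≰y t₁∧t₂≤y =
      ¬≤lowerCover y⋖x (subst (_≤ y) y∨t₁∧t₂≡x (∨-least ≤-refl t₁∧t₂≤y))
      where
      y∨t₁≡x = lowerCover-join y⋖x t₁≤x t₁≰y
      y∨t₁∧t₂≡x : y ∨ (t₁ ∧ t₂) ≡ x
      y∨t₁∧t₂≡x = trans (jsd y t₁ t₂ (trans y∨t₁≡x (sym (lowerCover-join y⋖x t₂≤x t₂≰y)))) y∨t₁≡x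

    leastOutside : ∀ {y x} → y ⋖ x → ∃ (IsLeastOutside y x)
    leastOutside {y} {x} y⋖x with minimal-below (λ t → t ≤? x ×-dec ¬? (t ≤? y)) (≤-refl , ¬≤lowerCover y⋖x)
    ... | a , _ , (a≤x , a≰y) , minimal = a , a≤x , a≰y , least
      where
      least : ∀ t → t ≤ x → ¬ t ≤ y → a ≤ t
      least t t≤x t≰y with a ∧ t ≟ a
      ... | yes a∧t≡a = subst (_≤ t) a∧t≡a (x∧y≤y a t)
      ... | no a∧t≢a  = ⊥-elim (minimal (x∧y≤x a t , a∧t≢a)
                                (≤-trans (x∧y≤x a t) a≤x , meet-outside-lowerCover y⋖x a≤x t≤x a≰y t≰y))

    Γ-isJoin : ∀ x → IsJoinOf L (Γ x) x
    Γ-isJoin x = (λ a a∈Γx → proj₁ (proj₂ (proj₂ (∈Γ⁻ a∈Γx)))) , least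
      where
      least : ∀ z → (∀ a → a ∈ Γ x → a ≤ z) → x ≤ z
      least z Γx≤z with x ≤? z
      ... | yes x≤z = x≤z
      ... | no x≰z with lowerCover-above (∧-< x≰z)
      ...   | y , x∧z≤y , y⋖x with leastOutside y⋖x
      ...     | a , a-least@(a≤x , a≰y , _) =
        ⊥-elim (a≰y (≤-trans (∧-greatest a≤x (Γx≤z a (∈Γ⁺ (y , y⋖x , a-least)))) x∧z≤y))

    Γ-isCanonical : ∀ x → IsCanonicalJoinRep L x (Γ x)
    Γ-isCanonical x = Γ-isJoin x , Γ-irredundant x , Γ-refines x

  module JoinIrreducibleElement {j} (ji : JoinIrreducible L j) where

    j* : Fin n
    j* = proj₁ (proj₁ ji)

    j*⋖j : j* ⋖ j
    j*⋖j = proj₂ (proj₁ ji)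

    j*≤j : j* ≤ j
    j*≤j = proj₁ (proj₁ j*⋖j)

    j≰j* : ¬ j ≤ j*
    j≰j* = ¬≤lowerCover j*⋖j

    <j⇒≤j* : ∀ {t} → t ≤ j → t ≢ j → t ≤ j*
    <j⇒≤j* {t} t≤j t≢j with proj₂ j*⋖j (t ∨ j*) (y≤x∨y t j*) (∨-least t≤j j*≤j)
    ... | inj₁ t∨j*≡j* = subst (t ≤_) t∨j*≡j* (x≤x∨y t j*)
    ... | inj₂ t∨j*≡j with proj₂ ji t j* (sym t∨j*≡j)
    ...   | inj₁ j≡t  = ⊥-elim (t≢j (sym j≡t))
    ...   | inj₂ j≡j* = ⊥-elim (j≰j* (subst (j ≤_) j≡j* ≤-refl))

    meet≡j* : ∀ {t} → j* ≤ t → ¬ j ≤ t → j ∧ t ≡ j*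
    meet≡j* j*≤t j≰t =
      antisym (<j⇒≤j* (x∧y≤x _ _) (λ j∧t≡j → j≰t (subst (_≤ _) j∧t≡j (x∧y≤y _ _))))
              (∧-greatest j*≤j j*≤t)

    ≢join : ∀ {p q} → ¬ j ≤ p → ¬ j ≤ q → j ≢ p ∨ q
    ≢join j≰p j≰q j≡p∨q with proj₂ ji _ _ j≡p∨q
    ... | inj₁ j≡p = j≰p (subst (j ≤_) j≡p ≤-refl)
    ... | inj₂ j≡q = j≰q (subst (j ≤_) j≡q ≤-refl)

    isGamma-join : ∀ {u} → j* ≤ u → ¬ j ≤ u → ∃[ w ] (u ≤ w × w ⋖ (u ∨ j) × IsGamma L w (u ∨ j) j)
    isGamma-join {u} j*≤u j≰u with lowerCover-above (<∨ j≰u)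
    ... | w , u≤w , w⋖v = w , u≤w , w⋖v , ji , j* , j*⋖j , inj₁ (j∨w≡v , meet≡j* (≤-trans j*≤u u≤w) j≰w)
      where
      j≰w : ¬ j ≤ w
      j≰w j≤w = ¬≤lowerCover w⋖v (∨-least u≤w j≤w)
      j∨w≡v : j ∨ w ≡ u ∨ j
      j∨w≡v = trans (∨-comm j w) (lowerCover-join w⋖v (y≤x∨y u j) j≰w)

    ≤join⇒≤join-j* : MeetSemidistributive L → ∀ {p q} → j ≤ (p ∨ q) → j ≤ (p ∨ j*) ⊎ j ≤ (q ∨ j*)
    ≤join⇒≤join-j* msd {p} {q} j≤p∨q with j ≤? (p ∨ j*) | j ≤? (q ∨ j*)
    ... | yes j≤p∨j* | _          = inj₁ j≤p∨j*
    ... | no _       | yes j≤q∨j* = inj₂ j≤q∨j*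
    ... | no j≰p∨j*  | no j≰q∨j*  = ⊥-elim (j≰j* (subst (j ≤_) (trans (sym j∧s≡j) j∧s≡j*) ≤-refl))
      where
      j∧p∨j*≡j* = meet≡j* (y≤x∨y p j*) j≰p∨j*
      j∧s≡j* : j ∧ ((p ∨ j*) ∨ (q ∨ j*)) ≡ j*
      j∧s≡j* = trans (msd j _ _ (trans j∧p∨j*≡j* (sym (meet≡j* (y≤x∨y q j*) j≰q∨j*)))) j∧p∨j*≡j*
      j∧s≡j : j ∧ ((p ∨ j*) ∨ (q ∨ j*)) ≡ j
      j∧s≡j = ≤⇒∧≡ (≤-trans j≤p∨q (∨-monotonic (x≤x∨y p j*) (x≤x∨y q j*)))

  JoinPrime : Fin n → Set
  JoinPrime j = ∀ p q → j ≤ (p ∨ q) → j ≤ p ⊎ j ≤ q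

  module _ (msd : MeetSemidistributive L) (Ψ⊆Γ : ∀ {x j} → InΨ L x j → j ∈ Γ x)
           {j} (ji : JoinIrreducible L j) where
    open JoinIrreducibleElement ji

    -- The nucleus d of x lies below y, so j ≰ d.  Either j = γ(w, d ∨ j* ∨ j)
    -- puts j in Ψ(x), or absorb gives d ∨ j* = x, which lies below any lower
    -- cover of x above j.
    lowerCover-avoiding : ∀ {x y} → j ≤ x → j ≢ x → j ∉ Γ x → y ⋖ x → ¬ j ≤ y →
                          (∀ {d} → d ≤ x → ¬ j ≤ d → j ≤ (d ∨ j*) → (d ∨ j*) ≡ x) → ⊥
    lowerCover-avoiding {x} {y} j≤x j≢x j∉Γx y⋖x j≰y absorb with nucleus x
    ... | d , d-nucleus@(d≤x , d≤lowerCovers , _) with j ≤? (d ∨ j*)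
    ...   | no j≰d∨j* =
      let (w , d∨j*≤w , w⋖v , w-γ) = isGamma-join (y≤x∨y d j*) j≰d∨j* in
      j∉Γx (Ψ⊆Γ (d , d-nucleus , w , (d ∨ j*) ∨ j , ≤-trans (x≤x∨y d j*) d∨j*≤w , w⋖v ,
                 ∨-least (∨-least d≤x (≤-trans j*≤j j≤x)) j≤x , w-γ))
    ...   | yes j≤d∨j* with lowerCover-above (j≤x , j≢x)
    ...     | y′ , j≤y′ , y′⋖x =
      ¬≤lowerCover y′⋖x (subst (_≤ y′) (absorb d≤x j≰d j≤d∨j*) (∨-least (d≤lowerCovers y′ y′⋖x) (≤-trans j*≤j j≤y′)))
      where
      j≰d : ¬ j ≤ d
      j≰d j≤d = j≰y (≤-trans j≤d (d≤lowerCovers y y⋖x))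

    -- Induction on p ∨ q; absorb packages the induction hypothesis.
    no-avoiding-join : ∀ p q → Acc _<_ (p ∨ q) → j ≤ (p ∨ q) → ¬ j ≤ p → ¬ j ≤ q → ⊥
    no-avoiding-join p q (acc rs) j≤x j≰p j≰q =
      [ avoided-by (x≤x∨y p q) j≰p , avoided-by (y≤x∨y p q) j≰q ]′ (≤join⇒≤join-j* msd j≤x)
      where
      absorb : ∀ {d} → d ≤ (p ∨ q) → ¬ j ≤ d → j ≤ (d ∨ j*) → (d ∨ j*) ≡ p ∨ q
      absorb {d} d≤x j≰d j≤d∨j* with (d ∨ j*) ≟ (p ∨ q)
      ... | yes d∨j*≡x = d∨j*≡x
      ... | no  d∨j*≢x =
        ⊥-elim (no-avoiding-join d j* (rs (∨-least d≤x (≤-trans j*≤j j≤x) , d∨j*≢x)) j≤d∨j* j≰d j≰j*)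
      avoided-by : ∀ {p′} → p′ ≤ (p ∨ q) → ¬ j ≤ p′ → j ≤ (p′ ∨ j*) → ⊥
      avoided-by {p′} p′≤x j≰p′ j≤p′∨j* with lowerCover-above (p′≤x , λ p′≡x → j≰p′ (subst (j ≤_) (sym p′≡x) j≤x))
      ... | y , p′≤y , y⋖x =
        lowerCover-avoiding j≤x (≢join j≰p j≰q) (λ j∈Γx → [ j≰p , j≰q ]′ (Γ-joinPrime j∈Γx)) y⋖x j≰y absorb
        where
        j≰y : ¬ j ≤ y
        j≰y j≤y = ¬≤lowerCover y⋖x (subst (_≤ y) (absorb p′≤x j≰p′ j≤p′∨j*) (∨-least p′≤y (≤-trans j*≤j j≤y)))

    joinIrreducible⇒joinPrime : JoinPrime j
    joinIrreducible⇒joinPrime p q j≤p∨q with j ≤? p | j ≤? q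
    ... | yes j≤p | _       = inj₁ j≤p
    ... | no _    | yes j≤q = inj₂ j≤q
    ... | no j≰p  | no j≰q  = ⊥-elim (no-avoiding-join p q (<-wellFounded _) j≤p∨q j≰p j≰q)

  no-lowerCover⇒≤ : ∀ {w} → ¬ ∃ (_⋖ w) → ∀ r → w ≤ r
  no-lowerCover⇒≤ {w} ∄cover r with w ≤? r
  ... | yes w≤r = w≤r
  ... | no  w≰r = ⊥-elim (∄cover (proj₁ cover , proj₂ (proj₂ cover)))
    where cover = lowerCover-above (∧-< w≰r)

  joinIrreducible-or-split : ∀ {w} → ∃ (_⋖ w) → JoinIrreducible L w ⊎ ∃₂ λ p q → (p ∨ q) ≡ w × p < w × q < w
  joinIrreducible-or-split {w} cover
    with any? (λ p → any? (λ q → ((p ∨ q) ≟ w) ×-dec ¬? (p ≟ w) ×-dec ¬? (q ≟ w)))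
  ... | yes (p , q , p∨q≡w , p≢w , q≢w) =
    inj₂ (p , q , p∨q≡w , (subst (p ≤_) p∨q≡w (x≤x∨y p q) , p≢w) , (subst (q ≤_) p∨q≡w (y≤x∨y p q) , q≢w))
  ... | no ∄split = inj₁ (cover , irreducible)
    where
    irreducible : ∀ p q → w ≡ p ∨ q → w ≡ p ⊎ w ≡ q
    irreducible p q w≡p∨q with w ≟ p | w ≟ q
    ... | yes w≡p | _       = inj₁ w≡p
    ... | no _    | yes w≡q = inj₂ w≡q
    ... | no w≢p  | no w≢q  = ⊥-elim (∄split (p , q , sym w≡p∨q , (λ p≡w → w≢p (sym p≡w)) , λ q≡w → w≢q (sym q≡w)))

  ≤-via-joinIrreducibles : ∀ {t r} → (∀ {j} → JoinIrreducible L j → j ≤ t → j ≤ r) → t ≤ r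
  ≤-via-joinIrreducibles {t} {r} joinIrreducible≤r = go t (<-wellFounded t) ≤-refl
    where
    go : ∀ w → Acc _<_ w → w ≤ t → w ≤ r
    go w (acc rs) w≤t with any? (_⋖? w)
    ... | no ∄cover = no-lowerCover⇒≤ ∄cover r
    ... | yes cover with joinIrreducible-or-split cover
    ...   | inj₁ w-ji = joinIrreducible≤r w-ji w≤t
    ...   | inj₂ (p , q , p∨q≡w , p<w , q<w) =
      subst (_≤ r) p∨q≡w (∨-least (go p (rs p<w) (≤-trans (proj₁ p<w) w≤t)) (go q (rs q<w) (≤-trans (proj₁ q<w) w≤t)))

  joinPrime⇒distributive : (∀ {j} → JoinIrreducible L j → JoinPrime j) → Distributive L
  joinPrime⇒distributive prime x y z = antisym (≤-via-joinIrreducibles split) distributive-≥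
    where
    split : ∀ {j} → JoinIrreducible L j → j ≤ (x ∧ (y ∨ z)) → j ≤ ((x ∧ y) ∨ (x ∧ z))
    split ji j≤ with prime ji y z (≤-trans j≤ (x∧y≤y x _))
    ... | inj₁ j≤y = ≤-trans (∧-greatest (≤-trans j≤ (x∧y≤x x _)) j≤y) (x≤x∨y _ _)
    ... | inj₂ j≤z = ≤-trans (∧-greatest (≤-trans j≤ (x∧y≤x x _)) j≤z) (y≤x∨y _ _)
    distributive-≥ : ((x ∧ y) ∨ (x ∧ z)) ≤ (x ∧ (y ∨ z))
    distributive-≥ = ∨-least (∧-greatest (x∧y≤x x y) (≤-trans (x∧y≤y x y) (x≤x∨y y z)))
                             (∧-greatest (x∧y≤x x z) (≤-trans (x∧y≤y x z) (y≤x∨y y z)))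

proposition3p5 : (L : FinLattice) → CongruenceUniform L →
    (∀ (x : Fin (FinLattice.n L)) (X : Subset (FinLattice.n L)) → IsCanonicalJoinRep L x X →
      ∀ j → (j ∈ X → InΨ L x j) × (InΨ L x j → j ∈ X)) →
    Distributive L
proposition3p5 L congruenceUniform Γ≡Ψ = joinPrime⇒distributive (joinIrreducible⇒joinPrime msd Ψ⊆Γ)
  where
  open FiniteLattice L
  jsd = proj₁ (congruenceUniform⇒semidistributive L congruenceUniform)
  msd = proj₂ (congruenceUniform⇒semidistributive L congruenceUniform)
  Ψ⊆Γ : ∀ {x j} → InΨ L x j → j ∈ Γ x
  Ψ⊆Γ {x} {j} = proj₂ (Γ≡Ψ x (Γ x) (Γ-isCanonical jsd x) j)
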